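{- Let $G$ be a cubic graph on $n$ vertices, and let $(W,B)$ be a (proper) stable-tree decomposition of $G$. Then $n=4k-2$ for some $k\in\mathbb{N}$, and moreover $|W|=k$.
   Context: A (proper) stable-tree decomposition of a graph $G$ is a partition of $V(G)$ into two sets $W$ and $B$ such that $W$ is a stable (independent) set and the induced subgraph $G[B]$ is a tree. -}

module Defs where

open import Data.Nat using (ℕ; _≤_)
open import Data.Fin using (Fin)
open import Data.Fin.Subset using (Subset; _∈_; _∉_; ∁; ∣_∣)
open import Data.List using (List; []; _∷_; _∷ʳ_; length)
open import Data.List.Relation.Unary.All using (All)
open import Data.List.Relation.Unary.Linked using (Linked)
open import Data.List.Relation.Unary.Unique.Propositional using (Unique)
open import Data.Product using (Σ; _×_; ∃; ∃-syntax)
open import Relation.Nullary using (¬_)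

record Graph (n : ℕ) : Set where
  field
    nbr      : Fin n → Subset n
    symmetric : ∀ {x y} → y ∈ nbr x → x ∈ nbr y
    loopless  : ∀ x → x ∉ nbr x

module _ {n : ℕ} (G : Graph n) where
  open Graph G

  Adj : Fin n → Fin n → Set
  Adj x y = y ∈ nbr x

  Cubic : Set
  Cubic = ∀ v → ∣ nbr v ∣ ≡ 3
    where open import Relation.Binary.PropositionalEquality using (_≡_)

  Stable : Subset n → Set
  Stable S = ∀ {x y} → x ∈ S → y ∈ S → ¬ Adj x y

  data Walk (S : Subset n) : Fin n → Fin n → Set where
    stop : ∀ {x} → x ∈ S → Walk S x x
    step : ∀ {x y z} → x ∈ S → Adj x y → Walk S y z → Walk S x z

  Connected : Subset n → Set
  Connected S = (∃[ v ] v ∈ S) × (∀ {x y} → x ∈ S → y ∈ S → Walk S x y)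

  HasCycle : Subset n → Set
  HasCycle S = ∃[ v ] ∃[ vs ]
      (2 ≤ length vs) × Unique (v ∷ vs) × All (_∈ S) (v ∷ vs)
        × Linked Adj ((v ∷ vs) ∷ʳ v)

  IsTree : Subset n → Set
  IsTree S = Connected S × ¬ HasCycle S

  StableTreeDecomposition : Subset n → Set
  StableTreeDecomposition W = Stable W × IsTree (∁ W)

-- Write ⟨f, g⟩ = Σ_v f(v) Σ_{u ~ v} g(u) for the adjacency form (adjForm); on indicator
-- vectors ⟨A, C⟩ counts ordered adjacent pairs from A to C. Every vertex has three
-- neighbours, so ⟨W, W⟩ + ⟨W, B⟩ = 3|W| and ⟨B, W⟩ + ⟨B, B⟩ = 3|B|. Stability gives
-- ⟨W, W⟩ = 0, the form is symmetric, and a tree on B has |B| − 1 edges, i.e.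
-- ⟨B, B⟩ = 2|B| − 2: deleting a leaf (the end of a maximal path, which cannot close
-- into a cycle) leaves a tree and lowers ⟨B, B⟩ by 2. Hence 3|W| = |B| + 2 and
-- n + 2 = |W| + |B| + 2 = 4|W|.
module Submission where

open import Defs
open import Data.Bool using (true; false; not; if_then_else_)
open import Data.Empty using (⊥-elim)
open import Data.Fin using (Fin; zero; suc; punchIn; _≟_)
open import Data.Fin.Properties using (punchInᵢ≢i; injective⇒≤; any?)
open import Data.Fin.Subset using (Subset; _∈_; _∉_; ∁; ∣_∣; ⁅_⁆; _─_; _-_; outside)
open import Data.Fin.Subset.Properties
  using (_∈?_; x∈⁅x⁆; x∈⁅y⁆⇒x≡y; x≢y⇒x∉⁅y⁆; x∉⁅y⁆⇒x≢y; ∣⁅x⁆∣≡1; ⊆-antisym;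
         p─q⊆p; x∈p∧x≢y⇒x∈p-y; x∈p⇒∣p-x∣<∣p∣; ∣∁p∣≡n∸∣p∣; ∣p∣≤n)
open import Data.List using (List; []; _∷_; _++_; _∷ʳ_; [_]; length; lookup)
open import Data.List.Properties using (∷ʳ-++; length-++-≤ʳ)
open import Data.List.Membership.Propositional using () renaming (_∈_ to _∈ₗ_)
open import Data.List.Membership.Propositional.Properties using (∈-lookup; ∈-∃++)
import Data.List.Relation.Unary.All as All
open import Data.List.Relation.Unary.All using (All; []; _∷_)
open import Data.List.Relation.Unary.All.Properties using (++⁻ˡ; ¬Any⇒All¬)
open import Data.List.Relation.Unary.AllPairs using (AllPairs; []; _∷_)
open import Data.List.Relation.Unary.Any using (here; there)
import Data.List.Relation.Unary.Linked as Linked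
open import Data.List.Relation.Unary.Linked using (Linked; []; [-]; _∷_)
open import Data.List.Relation.Unary.Unique.Propositional using (Unique)
open import Data.Nat using (ℕ; zero; suc; _+_; _*_; _∸_; _≤_; _<_; s≤s)
open import Data.Nat.Induction using (<-wellFounded)
open import Data.Nat.Properties
  using (+-identityʳ; +-assoc; +-cancelˡ-≡; *-identityˡ; *-identityʳ; *-zeroʳ; *-comm;
         *-distribˡ-+; ∸-monoʳ-<; ≤-refl; m+[n∸m]≡n; +-*-semiring)
open import Algebra.Properties.Semiring.Sum +-*-semiring
  using (sum; sum-syntax; sum-cong-≗; sum-remove; sum-replicate-zero; ∑-comm; ∑-distrib-+;
         *-distribˡ-sum; *-distribʳ-sum)
open import Data.Nat.Tactic.RingSolver using (solve-∀)
open import Data.Product using (∃-syntax; _×_; _,_; proj₁)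
open import Data.Vec using ([]; _∷_; here; there) renaming (lookup to lookupᵥ)
open import Data.Vec.Properties using ([]=⇒lookup; lookup⇒[]=; lookup-map)
open import Function using (_∘_)
open import Function.Definitions using (Injective)
open import Induction.WellFounded using (Acc; acc)
open import Relation.Binary.PropositionalEquality
  using (_≡_; _≢_; refl; sym; trans; cong; cong₂; subst; module ≡-Reasoning)
open import Relation.Nullary using (¬_; yes; no)
open import Relation.Nullary.Decidable using (_×-dec_; ¬?; decidable-stable)

∑-zero : ∀ {n} (f : Fin n → ℕ) → (∀ i → f i ≡ 0) → ∑[ i < n ] f i ≡ 0
∑-zero {n} f f≡0 = trans (sum-cong-≗ f≡0) (sum-replicate-zero n)

∑-supported : ∀ {n} (f : Fin n → ℕ) (i : Fin n) → (∀ j → j ≢ i → f j ≡ 0) → ∑[ j < n ] f j ≡ f i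
∑-supported {suc n} f i off = begin
  sum f                      ≡⟨ sum-remove {i = i} f ⟩
  f i + sum (f ∘ punchIn i)  ≡⟨ cong (f i +_) (∑-zero _ (λ j → off _ (punchInᵢ≢i i j))) ⟩
  f i + 0                    ≡⟨ +-identityʳ (f i) ⟩
  f i                        ∎
  where open ≡-Reasoning

module _ {A : Set} {R : A → A → Set} where

  AllPairs-++⁻ˡ : ∀ xs {ys} → AllPairs R (xs ++ ys) → AllPairs R xs
  AllPairs-++⁻ˡ []       _          = []
  AllPairs-++⁻ˡ (x ∷ xs) (rx ∷ rxs) = ++⁻ˡ xs rx ∷ AllPairs-++⁻ˡ xs rxs

  Linked-++⁻ˡ : ∀ xs {ys} → Linked R (xs ++ ys) → Linked R xs
  Linked-++⁻ˡ []           _        = []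
  Linked-++⁻ˡ (x ∷ [])     _        = [-]
  Linked-++⁻ˡ (x ∷ y ∷ xs) (r ∷ rs) = r ∷ Linked-++⁻ˡ (y ∷ xs) rs

  Linked-∷ʳ⁺ : ∀ xs {y z} → Linked R (xs ∷ʳ y) → R y z → Linked R (xs ∷ʳ y ∷ʳ z)
  Linked-∷ʳ⁺ []           _        ryz = ryz ∷ [-]
  Linked-∷ʳ⁺ (x ∷ [])     (r ∷ _)  ryz = r ∷ ryz ∷ [-]
  Linked-∷ʳ⁺ (x ∷ y ∷ xs) (r ∷ rs) ryz = r ∷ Linked-∷ʳ⁺ (y ∷ xs) rs ryz

Unique⇒lookup-injective : ∀ {A : Set} {xs : List A} → Unique xs → Injective _≡_ _≡_ (lookup xs)
Unique⇒lookup-injective (x∉xs ∷ _)  {zero}  {zero}  _  = refl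
Unique⇒lookup-injective (x∉xs ∷ _)  {zero}  {suc j} eq = ⊥-elim (All.lookup x∉xs (∈-lookup j) eq)
Unique⇒lookup-injective (x∉xs ∷ _)  {suc i} {zero}  eq = ⊥-elim (All.lookup x∉xs (∈-lookup i) (sym eq))
Unique⇒lookup-injective (_ ∷ uxs)   {suc i} {suc j} eq = cong suc (Unique⇒lookup-injective uxs eq)

Unique⇒length≤ : ∀ {n} {xs : List (Fin n)} → Unique xs → length xs ≤ n
Unique⇒length≤ uxs = injective⇒≤ (Unique⇒lookup-injective uxs)

x∈p─q⇒x∉q : ∀ {n} {p q : Subset n} {x} → x ∈ p ─ q → x ∉ q
x∈p─q⇒x∉q {p = _ ∷ p} {outside ∷ q} here ()
x∈p─q⇒x∉q {p = _ ∷ p} {_ ∷ q} (there x∈p─q) (there x∈q) = x∈p─q⇒x∉q x∈p─q x∈q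

x∈p-y⇒x≢y : ∀ {n} {p : Subset n} {x y} → x ∈ p - y → x ≢ y
x∈p-y⇒x≢y = x∉⁅y⁆⇒x≢y ∘ x∈p─q⇒x∉q

only-member⇒≡⁅⁆ : ∀ {n} {p : Subset n} {v} → v ∈ p → (∀ {u} → u ∈ p → u ≡ v) → p ≡ ⁅ v ⁆
only-member⇒≡⁅⁆ {p = p} {v} v∈p only =
  ⊆-antisym (λ u∈p → subst (_∈ ⁅ v ⁆) (sym (only u∈p)) (x∈⁅x⁆ v))
            (λ {u} u∈⁅v⁆ → subst (_∈ p) (sym (x∈⁅y⁆⇒x≡y v u∈⁅v⁆)) v∈p)

𝟙 : ∀ {n} → Subset n → Fin n → ℕ
𝟙 p v = if lookupᵥ p v then 1 else 0

𝟙-∈ : ∀ {n} {p : Subset n} {v} → v ∈ p → 𝟙 p v ≡ 1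
𝟙-∈ v∈p rewrite []=⇒lookup v∈p = refl

𝟙-∉ : ∀ {n} {p : Subset n} {v} → v ∉ p → 𝟙 p v ≡ 0
𝟙-∉ {p = p} {v} v∉p with lookupᵥ p v in eq
... | true  = ⊥-elim (v∉p (lookup⇒[]= v p eq))
... | false = refl

𝟙-≡ : ∀ {n} {p q : Subset n} {x y} → (x ∈ p → y ∈ q) → (y ∈ q → x ∈ p) → 𝟙 p x ≡ 𝟙 q y
𝟙-≡ {p = p} {x = x} to from with x ∈? p
... | yes x∈p = trans (𝟙-∈ x∈p) (sym (𝟙-∈ (to x∈p)))
... | no  x∉p = trans (𝟙-∉ x∉p) (sym (𝟙-∉ (x∉p ∘ from)))

𝟙-∁ : ∀ {n} (p : Subset n) v → 𝟙 p v + 𝟙 (∁ p) v ≡ 1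
𝟙-∁ p v rewrite lookup-map v not p with lookupᵥ p v
... | true  = refl
... | false = refl

𝟙-remove : ∀ {n} {p : Subset n} {x} → x ∈ p → ∀ v → 𝟙 p v ≡ 𝟙 (p - x) v + 𝟙 ⁅ x ⁆ v
𝟙-remove {p = p} {x} x∈p v with v ≟ x
... | yes refl = begin
  𝟙 p x                         ≡⟨ 𝟙-∈ x∈p ⟩
  0 + 1                         ≡⟨ cong₂ _+_ (𝟙-∉ x∉p-x) (𝟙-∈ (x∈⁅x⁆ x)) ⟨
  𝟙 (p - x) x + 𝟙 ⁅ x ⁆ x       ∎
  where
  open ≡-Reasoning
  x∉p-x : x ∉ p - x
  x∉p-x x∈p-x = x∈p-y⇒x≢y {p = p} x∈p-x refl
... | no v≢x = begin
  𝟙 p v                         ≡⟨ 𝟙-≡ (λ v∈p → x∈p∧x≢y⇒x∈p-y v∈p v≢x) (p─q⊆p p ⁅ x ⁆) ⟩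
  𝟙 (p - x) v                   ≡⟨ +-identityʳ _ ⟨
  𝟙 (p - x) v + 0               ≡⟨ cong (𝟙 (p - x) v +_) (𝟙-∉ (x≢y⇒x∉⁅y⁆ v≢x)) ⟨
  𝟙 (p - x) v + 𝟙 ⁅ x ⁆ v       ∎
  where open ≡-Reasoning

∣p∣≡∑𝟙 : ∀ {n} (p : Subset n) → ∣ p ∣ ≡ ∑[ v < n ] 𝟙 p v
∣p∣≡∑𝟙 []            = refl
∣p∣≡∑𝟙 (true ∷ p)  = cong suc (∣p∣≡∑𝟙 p)
∣p∣≡∑𝟙 (false ∷ p) = ∣p∣≡∑𝟙 p

∣p∣≡∣p-x∣+1 : ∀ {n} {p : Subset n} {x} → x ∈ p → ∣ p ∣ ≡ ∣ p - x ∣ + 1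
∣p∣≡∣p-x∣+1 {n} {p} {x} x∈p = begin
  ∣ p ∣                                             ≡⟨ ∣p∣≡∑𝟙 p ⟩
  ∑[ v < n ] 𝟙 p v                                  ≡⟨ sum-cong-≗ (𝟙-remove x∈p) ⟩
  ∑[ v < n ] (𝟙 (p - x) v + 𝟙 ⁅ x ⁆ v)              ≡⟨ ∑-distrib-+ (𝟙 (p - x)) (𝟙 ⁅ x ⁆) ⟩
  ∑[ v < n ] 𝟙 (p - x) v + ∑[ v < n ] 𝟙 ⁅ x ⁆ v     ≡⟨ cong₂ _+_ (∣p∣≡∑𝟙 (p - x)) (∣p∣≡∑𝟙 ⁅ x ⁆) ⟨
  ∣ p - x ∣ + ∣ ⁅ x ⁆ ∣                             ≡⟨ cong (∣ p - x ∣ +_) (∣⁅x⁆∣≡1 x) ⟩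
  ∣ p - x ∣ + 1                                     ∎
  where open ≡-Reasoning

∣p∣+∣∁p∣≡n : ∀ {n} (p : Subset n) → ∣ p ∣ + ∣ ∁ p ∣ ≡ n
∣p∣+∣∁p∣≡n p = trans (cong (∣ p ∣ +_) (∣∁p∣≡n∸∣p∣ p)) (m+[n∸m]≡n (∣p∣≤n p))

module _ {n : ℕ} (G : Graph n) where
  open Graph G
  open import Data.List.Membership.DecPropositional (_≟_ {n}) using () renaming (_∈?_ to _∈ₗ?_)

  adj : Fin n → Fin n → ℕ
  adj v = 𝟙 (nbr v)

  adj-sym : ∀ v u → adj v u ≡ adj u v
  adj-sym v u = 𝟙-≡ symmetric symmetric

  nbrSum : (Fin n → ℕ) → Fin n → ℕ
  nbrSum g v = ∑[ u < n ] (adj v u * g u)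

  adjForm : (Fin n → ℕ) → (Fin n → ℕ) → ℕ
  adjForm f g = ∑[ v < n ] (f v * nbrSum g v)

  adjForm-cong : ∀ {f f′ g g′} → (∀ v → f v ≡ f′ v) → (∀ v → g v ≡ g′ v) →
                 adjForm f g ≡ adjForm f′ g′
  adjForm-cong f≗f′ g≗g′ =
    sum-cong-≗ (λ v → cong₂ _*_ (f≗f′ v) (sum-cong-≗ (λ u → cong (adj v u *_) (g≗g′ u))))

  adjForm-comm : ∀ f g → adjForm f g ≡ adjForm g f
  adjForm-comm f g = begin
    ∑[ v < n ] (f v * ∑[ u < n ] (adj v u * g u))
      ≡⟨ sum-cong-≗ (λ v → *-distribˡ-sum (f v) (λ u → adj v u * g u)) ⟩
    ∑[ v < n ] ∑[ u < n ] (f v * (adj v u * g u))  ≡⟨ ∑-comm (λ v u → f v * (adj v u * g u)) ⟩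
    ∑[ u < n ] ∑[ v < n ] (f v * (adj v u * g u))
      ≡⟨ sum-cong-≗ (λ u → sum-cong-≗ (λ v → swap v u)) ⟩
    ∑[ u < n ] ∑[ v < n ] (g u * (adj u v * f v))
      ≡⟨ sum-cong-≗ (λ u → *-distribˡ-sum (g u) (λ v → adj u v * f v)) ⟨
    ∑[ u < n ] (g u * ∑[ v < n ] (adj u v * f v))  ∎
    where
    open ≡-Reasoning
    rearrange : ∀ x a y → x * (a * y) ≡ y * (a * x)
    rearrange = solve-∀
    swap : ∀ v u → f v * (adj v u * g u) ≡ g u * (adj u v * f v)
    swap v u rewrite adj-sym v u = rearrange (f v) (adj u v) (g u)

  nbrSum-+ : ∀ g h v → nbrSum (λ u → g u + h u) v ≡ nbrSum g v + nbrSum h v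
  nbrSum-+ g h v =
    trans (sum-cong-≗ (λ u → *-distribˡ-+ (adj v u) (g u) (h u))) (∑-distrib-+ (λ u → adj v u * g u) _)

  adjForm-distribʳ : ∀ f g h → adjForm f (λ u → g u + h u) ≡ adjForm f g + adjForm f h
  adjForm-distribʳ f g h = begin
    ∑[ v < n ] (f v * nbrSum (λ u → g u + h u) v)
      ≡⟨ sum-cong-≗ (λ v → cong (f v *_) (nbrSum-+ g h v)) ⟩
    ∑[ v < n ] (f v * (nbrSum g v + nbrSum h v))
      ≡⟨ sum-cong-≗ (λ v → *-distribˡ-+ (f v) _ _) ⟩
    ∑[ v < n ] (f v * nbrSum g v + f v * nbrSum h v)    ≡⟨ ∑-distrib-+ (λ v → f v * nbrSum g v) _ ⟩
    adjForm f g + adjForm f h                           ∎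
    where open ≡-Reasoning

  adjForm-distribˡ : ∀ f g h → adjForm (λ v → f v + g v) h ≡ adjForm f h + adjForm g h
  adjForm-distribˡ f g h = begin
    adjForm (λ v → f v + g v) h  ≡⟨ adjForm-comm _ h ⟩
    adjForm h (λ v → f v + g v)  ≡⟨ adjForm-distribʳ h f g ⟩
    adjForm h f + adjForm h g    ≡⟨ cong₂ _+_ (adjForm-comm h f) (adjForm-comm h g) ⟩
    adjForm f h + adjForm g h    ∎
    where open ≡-Reasoning

  adjForm-square : ∀ f g → let h = λ v → f v + g v in
                   adjForm h h ≡ adjForm f f + 2 * adjForm g f + adjForm g g
  adjForm-square f g = begin
    adjForm h h                                              ≡⟨ adjForm-distribˡ f g h ⟩
    adjForm f h + adjForm g h
      ≡⟨ cong₂ _+_ (adjForm-distribʳ f f g) (adjForm-distribʳ g f g) ⟩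
    adjForm f f + adjForm f g + (adjForm g f + adjForm g g)
      ≡⟨ cong (λ x → adjForm f f + x + (adjForm g f + adjForm g g)) (adjForm-comm f g) ⟩
    adjForm f f + adjForm g f + (adjForm g f + adjForm g g)
      ≡⟨ regroup (adjForm f f) (adjForm g f) (adjForm g g) ⟩
    adjForm f f + 2 * adjForm g f + adjForm g g              ∎
    where
    open ≡-Reasoning
    h = λ v → f v + g v
    regroup : ∀ a b c → a + b + (b + c) ≡ a + 2 * b + c
    regroup = solve-∀

  adjForm-regular : ∀ {r} → (∀ v → ∣ nbr v ∣ ≡ r) → ∀ f → adjForm f (λ _ → 1) ≡ r * ∑[ v < n ] f v
  adjForm-regular {r} deg f = begin
    ∑[ v < n ] (f v * nbrSum (λ _ → 1) v)  ≡⟨ sum-cong-≗ (λ v → cong (f v *_) (nbrSum-1 v)) ⟩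
    ∑[ v < n ] (f v * r)                   ≡⟨ *-distribʳ-sum r f ⟨
    (∑[ v < n ] f v) * r                   ≡⟨ *-comm _ r ⟩
    r * ∑[ v < n ] f v                     ∎
    where
    open ≡-Reasoning
    nbrSum-1 : ∀ v → nbrSum (λ _ → 1) v ≡ r
    nbrSum-1 v = trans (sum-cong-≗ (λ u → *-identityʳ (adj v u))) (trans (sym (∣p∣≡∑𝟙 (nbr v))) (deg v))

  adjForm-complement : ∀ {r} → (∀ v → ∣ nbr v ∣ ≡ r) → ∀ A C →
                       adjForm (𝟙 A) (𝟙 C) + adjForm (𝟙 A) (𝟙 (∁ C)) ≡ r * ∣ A ∣
  adjForm-complement {r} deg A C = begin
    adjForm (𝟙 A) (𝟙 C) + adjForm (𝟙 A) (𝟙 (∁ C))  ≡⟨ adjForm-distribʳ (𝟙 A) (𝟙 C) (𝟙 (∁ C)) ⟨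
    adjForm (𝟙 A) (λ u → 𝟙 C u + 𝟙 (∁ C) u)
      ≡⟨ adjForm-cong {𝟙 A} {𝟙 A} (λ _ → refl) (𝟙-∁ C) ⟩
    adjForm (𝟙 A) (λ _ → 1)                         ≡⟨ adjForm-regular deg (𝟙 A) ⟩
    r * ∑[ v < n ] 𝟙 A v                            ≡⟨ cong (r *_) (∣p∣≡∑𝟙 A) ⟨
    r * ∣ A ∣                                       ∎
    where open ≡-Reasoning

  adjForm-stable : ∀ {W} → Stable G W → adjForm (𝟙 W) (𝟙 W) ≡ 0
  adjForm-stable {W} stable = ∑-zero _ term≡0
    where
    term≡0 : ∀ v → 𝟙 W v * nbrSum (𝟙 W) v ≡ 0
    term≡0 v with v ∈? W
    ... | no v∉W  = cong (_* nbrSum (𝟙 W) v) (𝟙-∉ v∉W)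
    ... | yes v∈W = trans (cong (𝟙 W v *_) (∑-zero _ edge≡0)) (*-zeroʳ (𝟙 W v))
      where
      edge≡0 : ∀ u → adj v u * 𝟙 W u ≡ 0
      edge≡0 u with u ∈? W
      ... | no u∉W  = trans (cong (adj v u *_) (𝟙-∉ u∉W)) (*-zeroʳ (adj v u))
      ... | yes u∈W = cong (_* 𝟙 W u) (𝟙-∉ (stable v∈W u∈W))

  ⁅⁆-stable : ∀ v → Stable G ⁅ v ⁆
  ⁅⁆-stable v x∈⁅v⁆ y∈⁅v⁆ x~y
    rewrite x∈⁅y⁆⇒x≡y v x∈⁅v⁆ | x∈⁅y⁆⇒x≡y v y∈⁅v⁆ = loopless v x~y

  adjForm-⁅⁆ˡ : ∀ x g → adjForm (𝟙 ⁅ x ⁆) g ≡ nbrSum g x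
  adjForm-⁅⁆ˡ x g =
    trans (∑-supported _ x off) (trans (cong (_* nbrSum g x) (𝟙-∈ (x∈⁅x⁆ x))) (*-identityˡ _))
    where
    off : ∀ v → v ≢ x → 𝟙 ⁅ x ⁆ v * nbrSum g v ≡ 0
    off v v≢x = cong (_* nbrSum g v) (𝟙-∉ (x≢y⇒x∉⁅y⁆ v≢x))

  nbrSum-unique : ∀ {A v p} → p ∈ A → Adj G v p → (∀ {q} → q ∈ A → Adj G v q → q ≡ p) →
                  nbrSum (𝟙 A) v ≡ 1
  nbrSum-unique {A} {v} {p} p∈A v~p unique =
    trans (∑-supported _ p off) (cong₂ _*_ (𝟙-∈ v~p) (𝟙-∈ p∈A))
    where
    off : ∀ u → u ≢ p → adj v u * 𝟙 A u ≡ 0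
    off u u≢p with u ∈? A
    ... | no u∉A  = trans (cong (adj v u *_) (𝟙-∉ u∉A)) (*-zeroʳ (adj v u))
    ... | yes u∈A = cong (_* 𝟙 A u) (𝟙-∉ (u≢p ∘ unique u∈A))

  walk-start : ∀ {S x y} → Walk G S x y → x ∈ S
  walk-start (stop x∈S)     = x∈S
  walk-start (step x∈S _ _) = x∈S

  IsPath : Subset n → List (Fin n) → Set
  IsPath S xs = Unique xs × All (_∈ S) xs × Linked (Adj G) xs

  path-chord⇒cycle : ∀ {S x y ys q} → IsPath S (x ∷ y ∷ ys) → q ∈ₗ ys → Adj G x q → HasCycle G S
  path-chord⇒cycle {S} {x} {y} {q = q} path q∈ys x~q with ∈-∃++ q∈ys
  ... | as , bs , refl = close (subst (λ zs → IsPath S (x ∷ y ∷ zs)) (sym (∷ʳ-++ as q bs)) path)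
    where
    close : IsPath S (x ∷ y ∷ as ∷ʳ q ++ bs) → HasCycle G S
    close (uniq , all , linked) =
      x , y ∷ as ∷ʳ q , s≤s (length-++-≤ʳ [ q ] {as}) ,
      AllPairs-++⁻ˡ (x ∷ y ∷ as ∷ʳ q) uniq , ++⁻ˡ (x ∷ y ∷ as ∷ʳ q) all ,
      Linked-∷ʳ⁺ (x ∷ y ∷ as) (Linked-++⁻ˡ (x ∷ y ∷ as ∷ʳ q) linked) (symmetric x~q)

  record Leaf (S : Subset n) : Set where
    field
      leaf parent   : Fin n
      leaf∈S        : leaf ∈ S
      parent∈S      : parent ∈ S
      leaf~parent   : Adj G leaf parent
      parent-unique : ∀ {q} → q ∈ S → Adj G leaf q → q ≡ parent

  module _ {S : Subset n} (acyclic : ¬ HasCycle G S) where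

    maximal-path⇒leaf : ∀ x y ys → IsPath S (x ∷ y ∷ ys) → Acc _<_ (n ∸ length (x ∷ y ∷ ys)) → Leaf S
    maximal-path⇒leaf x y ys path@(uniq , all , linked) (acc shorter)
      with any? (λ q → q ∈? S ×-dec q ∈? nbr x ×-dec ¬? (q ∈ₗ? x ∷ y ∷ ys))
    ... | yes (q , q∈S , x~q , q∉path) =
      maximal-path⇒leaf q x (y ∷ ys) path′ (shorter (∸-monoʳ-< ≤-refl (Unique⇒length≤ (proj₁ path′))))
      where
      path′ : IsPath S (q ∷ x ∷ y ∷ ys)
      path′ = ¬Any⇒All¬ _ q∉path ∷ uniq , q∈S ∷ all , symmetric x~q ∷ linked
    ... | no stuck = record
      { leaf = x ; parent = y ; leaf∈S = All.head all ; parent∈S = All.head (All.tail all)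
      ; leaf~parent = Linked.head linked ; parent-unique = parent-unique }
      where
      parent-unique : ∀ {q} → q ∈ S → Adj G x q → q ≡ y
      parent-unique {q} q∈S x~q with q ∈ₗ? x ∷ y ∷ ys
      ... | no q∉path                = ⊥-elim (stuck (q , q∈S , x~q , q∉path))
      ... | yes (here refl)          = ⊥-elim (loopless x x~q)
      ... | yes (there (here q≡y))   = q≡y
      ... | yes (there (there q∈ys)) = ⊥-elim (acyclic (path-chord⇒cycle path q∈ys x~q))

    acyclic-edge⇒leaf : ∀ {x y} → x ∈ S → y ∈ S → Adj G x y → Leaf S
    acyclic-edge⇒leaf {x} {y} x∈S y∈S x~y = maximal-path⇒leaf y x [] path (<-wellFounded _)
      where
      path : IsPath S (y ∷ x ∷ [])
      path = ((λ y≡x → loopless x (subst (Adj G x) y≡x x~y)) ∷ []) ∷ [] ∷ [] ,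
             y∈S ∷ x∈S ∷ [] , symmetric x~y ∷ [-]

  module LeafRemoval {S : Subset n} (ℓ : Leaf S) where
    open Leaf ℓ

    parent≢leaf : parent ≢ leaf
    parent≢leaf p≡l = loopless leaf (subst (Adj G leaf) p≡l leaf~parent)

    -- A walk through the leaf enters and leaves it via the parent, so that detour can be cut out.
    walk-avoiding-leaf : ∀ {a b} → a ≢ leaf → b ≢ leaf → Walk G S a b → Walk G (S - leaf) a b
    walk-avoiding-leaf a≢l b≢l (stop a∈S) = stop (x∈p∧x≢y⇒x∈p-y a∈S a≢l)
    walk-avoiding-leaf a≢l b≢l (step {y = y} a∈S a~y w) with y ≟ leaf
    ... | no y≢l = step (x∈p∧x≢y⇒x∈p-y a∈S a≢l) a~y (walk-avoiding-leaf y≢l b≢l w)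
    walk-avoiding-leaf a≢l b≢l (step a∈S a~l (stop _))         | yes refl = ⊥-elim (b≢l refl)
    walk-avoiding-leaf a≢l b≢l (step a∈S a~l (step _ l~c c⟶b)) | yes refl =
      subst (λ t → Walk G (S - leaf) t _) (trans c≡parent (sym a≡parent))
            (walk-avoiding-leaf (λ c≡l → parent≢leaf (trans (sym c≡parent) c≡l)) b≢l c⟶b)
      where
      a≡parent = parent-unique a∈S (symmetric a~l)
      c≡parent = parent-unique (walk-start c⟶b) l~c

    remove-leaf-tree : IsTree G S → IsTree G (S - leaf)
    remove-leaf-tree ((_ , connected) , acyclic) =
      ((parent , x∈p∧x≢y⇒x∈p-y parent∈S parent≢leaf) ,
       λ a∈ b∈ → walk-avoiding-leaf (x∈p-y⇒x≢y a∈) (x∈p-y⇒x≢y b∈) (connected (⊆S a∈) (⊆S b∈))) ,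
      λ (v , vs , len , uniq , all , linked) → acyclic (v , vs , len , uniq , All.map ⊆S all , linked)
      where ⊆S = p─q⊆p S ⁅ leaf ⁆

    remove-leaf-adjForm : adjForm (𝟙 S) (𝟙 S) ≡ adjForm (𝟙 (S - leaf)) (𝟙 (S - leaf)) + 2
    remove-leaf-adjForm = begin
      adjForm (𝟙 S) (𝟙 S)
        ≡⟨ adjForm-cong split split ⟩
      adjForm (λ v → S′ v + L v) (λ v → S′ v + L v)                        ≡⟨ adjForm-square S′ L ⟩
      adjForm S′ S′ + 2 * adjForm L S′ + adjForm L L
        ≡⟨ cong₂ (λ a b → adjForm S′ S′ + 2 * a + b) leaf-degree (adjForm-stable (⁅⁆-stable leaf)) ⟩
      adjForm S′ S′ + 2 + 0                                                ≡⟨ +-identityʳ _ ⟩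
      adjForm S′ S′ + 2                                                    ∎
      where
      open ≡-Reasoning
      S′ = 𝟙 (S - leaf)
      L = 𝟙 ⁅ leaf ⁆
      split = 𝟙-remove leaf∈S
      leaf-degree : adjForm L S′ ≡ 1
      leaf-degree = trans (adjForm-⁅⁆ˡ leaf S′)
        (nbrSum-unique (x∈p∧x≢y⇒x∈p-y parent∈S parent≢leaf) leaf~parent
                       (λ q∈S′ → parent-unique (p─q⊆p S ⁅ leaf ⁆ q∈S′)))

  tree-adjForm : ∀ {S} → IsTree G S → adjForm (𝟙 S) (𝟙 S) + 2 ≡ 2 * ∣ S ∣
  tree-adjForm {S} tree = go tree (<-wellFounded ∣ S ∣)
    where
    go : ∀ {S} → IsTree G S → Acc _<_ ∣ S ∣ → adjForm (𝟙 S) (𝟙 S) + 2 ≡ 2 * ∣ S ∣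
    go {S} tree@(((v , v∈S) , connected) , acyclic) (acc smaller)
      with any? (λ u → u ∈? S ×-dec ¬? (u ≟ v))
    ... | no only-v = subst (λ T → adjForm (𝟙 T) (𝟙 T) + 2 ≡ 2 * ∣ T ∣) (sym S≡⁅v⁆)
      (trans (cong (_+ 2) (adjForm-stable (⁅⁆-stable v))) (cong (2 *_) (sym (∣⁅x⁆∣≡1 v))))
      where
      S≡⁅v⁆ : S ≡ ⁅ v ⁆
      S≡⁅v⁆ = only-member⇒≡⁅⁆ v∈S (λ {u} u∈S → decidable-stable (u ≟ v) (λ u≢v → only-v (u , u∈S , u≢v)))
    ... | yes (u , u∈S , u≢v) with connected v∈S u∈S
    ...   | stop _          = ⊥-elim (u≢v refl)
    ...   | step _ v~w w⟶u = begin
      adjForm (𝟙 S) (𝟙 S) + 2                ≡⟨ cong (_+ 2) remove-leaf-adjForm ⟩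
      adjForm (𝟙 S′) (𝟙 S′) + 2 + 2
        ≡⟨ cong (_+ 2) (go (remove-leaf-tree tree) (smaller (x∈p⇒∣p-x∣<∣p∣ leaf∈S))) ⟩
      2 * ∣ S′ ∣ + 2                         ≡⟨ 2m+2≡2[m+1] ∣ S′ ∣ ⟩
      2 * (∣ S′ ∣ + 1)                       ≡⟨ cong (2 *_) (∣p∣≡∣p-x∣+1 leaf∈S) ⟨
      2 * ∣ S ∣                              ∎
      where
      open ≡-Reasoning
      ℓ = acyclic-edge⇒leaf acyclic v∈S (walk-start w⟶u) v~w
      open Leaf ℓ
      open LeafRemoval ℓ
      S′ = S - leaf
      2m+2≡2[m+1] : ∀ m → 2 * m + 2 ≡ 2 * (m + 1)
      2m+2≡2[m+1] = solve-∀

w+3w≡4w : ∀ w → w + 3 * w ≡ 4 * w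
w+3w≡4w = solve-∀

three-w≡b+2 : ∀ w b x y → y ≡ 3 * w → y + x ≡ 3 * b → x + 2 ≡ 2 * b → 3 * w ≡ b + 2
three-w≡b+2 w b x y y≡3w y+x≡3b x+2≡2b = +-cancelˡ-≡ (2 * b) _ _ (begin
  2 * b + 3 * w  ≡⟨ cong₂ _+_ x+2≡2b y≡3w ⟨
  x + 2 + y      ≡⟨ rotate x y ⟩
  y + x + 2      ≡⟨ cong (_+ 2) y+x≡3b ⟩
  3 * b + 2      ≡⟨ split b ⟩
  2 * b + (b + 2) ∎)
  where
  open ≡-Reasoning
  rotate : ∀ x y → x + 2 + y ≡ y + x + 2
  rotate = solve-∀
  split : ∀ b → 3 * b + 2 ≡ 2 * b + (b + 2)
  split = solve-∀

lemma2 : (n : ℕ) (G : Graph n) → Cubic G → (W : Subset n)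
    → StableTreeDecomposition G W
    → ∃[ k ] (n + 2 ≡ 4 * k × ∣ W ∣ ≡ k)
lemma2 n G cubic W (stable , tree) = ∣ W ∣ , n+2≡4w , refl
  where
  open ≡-Reasoning
  B = ∁ W
  w = ∣ W ∣
  b = ∣ B ∣
  W-B-pairs : adjForm G (𝟙 W) (𝟙 B) ≡ 3 * w
  W-B-pairs = trans (cong (_+ adjForm G (𝟙 W) (𝟙 B)) (sym (adjForm-stable G stable)))
                    (adjForm-complement G cubic W W)
  B-pairs : adjForm G (𝟙 W) (𝟙 B) + adjForm G (𝟙 B) (𝟙 B) ≡ 3 * b
  B-pairs = trans (cong (_+ adjForm G (𝟙 B) (𝟙 B)) (adjForm-comm G (𝟙 W) (𝟙 B)))
                  (adjForm-complement G cubic B W)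
  n+2≡4w : n + 2 ≡ 4 * w
  n+2≡4w = begin
    n + 2          ≡⟨ cong (_+ 2) (∣p∣+∣∁p∣≡n W) ⟨
    w + b + 2      ≡⟨ +-assoc w b 2 ⟩
    w + (b + 2)    ≡⟨ cong (w +_) (three-w≡b+2 w b _ _ W-B-pairs B-pairs (tree-adjForm G tree)) ⟨
    w + 3 * w      ≡⟨ w+3w≡4w w ⟩
    4 * w          ∎
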